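{- For $1\leq r<s\leq n$, $$x_r^{ -1}\sum_{T\in \mathcal P_{n}^{(r)}}t^{{\rm eld}(T)}\prod_{i=1}^{n}x_i^{{\rm young}_T(i)}=x_s^{ -1}\sum_{T\in \mathcal P_{n}^{(s)}}t^{{\rm eld}(T)}\prod_{i=1}^{n}x_i^{{\rm young}_T(i)}.$$
   Context: A plane tree on a finite totally ordered set is a rooted tree in which the children of each vertex are linearly ordered (left to right). A vertex $j$ is a descendant of $i$ if the path from the root to $j$ passes through $i$ (each vertex is its own descendant); $\beta_T(i)$ is the smallest descendant of $i$. A child $j$ of $v$ is elder if $v$ has a child $k$ to the right of $j$ with $\beta_T(k)<\beta_T(j)$, and younger otherwise. ${\rm young}_T(v)$ is the number of younger children of $v$ and ${\rm eld}(T)$ is the total number of elder vertices of $T$. $\mathcal P_n^{(r)}$ is the set of plane trees on $[n]=\{1,\dots,n\}$ with root $r$. -}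

module Defs where

open import Data.Nat using (ℕ; zero; suc; _+_; _∸_; _⊓_; _<ᵇ_; _≡ᵇ_)
open import Data.Bool using (Bool; true; false; _∧_; _∨_; if_then_else_)
open import Data.Fin using (Fin; toℕ)
open import Data.Fin.Properties using (_≟_)
open import Data.List using (List; []; _∷_; _++_; length; allFin)
open import Relation.Binary.PropositionalEquality using (_≡_)
open import Data.Vec using (Vec; tabulate)
open import Data.Integer using (ℤ; +_) renaming (_-_ to _-ℤ_)
open import Data.Product using (_×_; _,_)
open import Relation.Nullary.Decidable using (⌊_⌋)

-- A plane (ordered, rooted) tree whose vertices are labelled by elements of
-- Fin n (standing for [n] = {1,…,n} via i ↦ toℕ i + 1, an order isomorphism).
-- The children of a vertex are listed from left to right.
data PTree (n : ℕ) : Set where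
  node : Fin n → List (PTree n) → PTree n

module _ {n : ℕ} where

  root : PTree n → Fin n
  root (node v _) = v

  mutual
    labels : PTree n → List (Fin n)
    labels (node v ts) = v ∷ labelsF ts

    labelsF : List (PTree n) → List (Fin n)
    labelsF [] = []
    labelsF (t ∷ ts) = labels t ++ labelsF ts

  occ : Fin n → List (Fin n) → ℕ
  occ i [] = 0
  occ i (j ∷ js) = (if ⌊ i ≟ j ⌋ then 1 else 0) + occ i js

  allB : (Fin n → Bool) → List (Fin n) → Bool
  allB p [] = true
  allB p (x ∷ xs) = p x ∧ allB p xs

  isOnAllOfN : PTree n → Bool
  isOnAllOfN T = allB (λ i → occ i (labels T) ≡ᵇ 1) (allFin n)

  IsPlaneTreeWithRoot : Fin n → PTree n → Set
  IsPlaneTreeWithRoot r T = (root T ≡ r) × (Data.Bool.T (isOnAllOfN T))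

  mutual
    β : PTree n → ℕ
    β (node v ts) = βF (toℕ v) ts

    βF : ℕ → List (PTree n) → ℕ
    βF m [] = m
    βF m (t ∷ ts) = βF (m ⊓ β t) ts

  someSmaller : ℕ → List (PTree n) → Bool
  someSmaller b [] = false
  someSmaller b (t ∷ ts) = (β t <ᵇ b) ∨ someSmaller b ts

  elderCount : List (PTree n) → ℕ
  elderCount [] = 0
  elderCount (t ∷ ts) = (if someSmaller (β t) ts then 1 else 0) + elderCount ts

  youngerCount : List (PTree n) → ℕ
  youngerCount ts = length ts ∸ elderCount ts

  mutual
    eld : PTree n → ℕ
    eld (node v ts) = elderCount ts + eldF ts

    eldF : List (PTree n) → ℕ
    eldF [] = 0
    eldF (t ∷ ts) = eld t + eldF ts

  mutual
    youngExp : PTree n → Fin n → ℕ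
    youngExp (node v ts) i = (if ⌊ i ≟ v ⌋ then youngerCount ts else 0) + youngExpF ts i

    youngExpF : List (PTree n) → Fin n → ℕ
    youngExpF [] i = 0
    youngExpF (t ∷ ts) i = youngExp t i + youngExpF ts i

  -- exponent data of the Laurent monomial  x_r^{-1} t^{eld T} ∏_i x_i^{young_T(i)}
  -- as (exponent of t , exponents of x_1..x_n)
  monomial : Fin n → PTree n → ℕ × Vec ℤ n
  monomial r T = eld T , tabulate (λ i → (+ youngExp T i) -ℤ (+ (if ⌊ i ≟ r ⌋ then 1 else 0)))

-- The children of a vertex fall into segments, each a run of elder children closed by the
-- younger child that follows them, so young(v) is the number of segments at v.  Rerooting from
-- r at s walks down the path from r to s.  At each vertex the segment containing the next vertex
-- of the path is cut out; its other members and the previous vertex are rotated into a new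
-- segment ending at the member with the smallest descendant, and this segment is inserted among
-- the segments of the vertex.  At r the cut segment is not replaced: its k other members travel
-- down to s and form the new segment there.  So every vertex keeps its numbers of elder and
-- younger children, except that r loses one younger and k elder children and s gains them;
-- eld is preserved and x_r^{-1} ∏ x_i^{young} becomes x_s^{-1} ∏ x_i^{young}.  Rerooting back at
-- r undoes every step, since a segment is the only rotation of its members ending at its
-- minimum and the segments of a vertex are ordered by their younger children.

module Submission where

open import Defs
open import Axiom.UniquenessOfIdentityProofs using (module Decidable⇒UIP)
open import Data.Bool using (Bool; true; false; if_then_else_; T; _∧_)
open import Data.Bool.Properties using (∨-zeroʳ; T-∧; T-irrelevant)
open import Data.Fin using (Fin; toℕ)
open import Data.Fin.Properties using (_≟_; toℕ-injective)
open import Data.Integer using (ℤ; _⊖_)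
import Data.Integer as ℤ
open import Data.Integer.Properties using ([+m]-[+n]≡m⊖n; +-cancelˡ-⊖)
import Data.Integer.Properties as ℤ
open import Data.List using (List; []; _∷_; _++_; _∷ʳ_; map; length; allFin; initLast; _∷ʳ′_)
open import Data.List.Membership.Propositional using (_∈_)
open import Data.List.Membership.Propositional.Properties using (∈-++⁺ʳ; ∈-allFin)
open import Data.List.NonEmpty using (List⁺; _∷_; toList) renaming (_∷ʳ_ to _⁺∷ʳ_)
open import Data.List.Properties using (map-++; ++-assoc; ∷-injective; ∷ʳ-injective; length-++)
open import Data.List.Relation.Binary.Permutation.Propositional
  using (_↭_; ↭-sym; ↭-trans; prep; module PermutationReasoning)
open import Data.List.Relation.Binary.Permutation.Propositional.Properties
  using (map⁺; shift; shifts; ++-comm; ++⁺ʳ; ∷↭∷ʳ; ↭-length; All-resp-↭)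
open import Data.List.Relation.Unary.All as All using (All; []; _∷_)
import Data.List.Relation.Unary.All.Properties as All
open import Data.List.Relation.Unary.Any using (here; there)
open import Data.Maybe using (Maybe; just; nothing)
import Data.Maybe as Maybe
open import Data.Nat using (ℕ; zero; suc; _+_; _∸_; _⊓_; _<_; _≤_; _<ᵇ_; _≤ᵇ_; _≡ᵇ_; z≤n; s≤s)
import Data.Nat as ℕ
open import Data.Nat.ListAction using (sum)
open import Data.Nat.ListAction.Properties using (sum-++; sum-↭)
open import Data.Nat.Properties hiding (_≟_)
open import Data.Nat.Tactic.RingSolver using (solve-∀)
open import Data.Product using (Σ; Σ-syntax; _×_; _,_; proj₁; proj₂; map₁; uncurry)
open import Data.Product.Properties using (≡-dec; Σ-≡,≡→≡)
open import Data.Sum using (_⊎_; inj₁; inj₂)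
open import Data.Unit using (⊤; tt)
open import Data.Vec using (Vec)
open import Data.Vec.Properties using (tabulate-cong)
import Data.Vec.Properties as Vec
open import Function using (_∘_; _$_)
open import Function.Bundles using (Equivalence; _↔_; mk↔ₛ′)
open import Relation.Binary.PropositionalEquality
open import Relation.Nullary using (Dec; yes; no; contradiction)
open import Relation.Nullary.Decidable using (⌊_⌋)

private variable A : Set

sumMap : (A → ℕ) → List A → ℕ
sumMap f xs = sum (map f xs)

sumMap-++ : ∀ (f : A → ℕ) xs ys → sumMap f (xs ++ ys) ≡ sumMap f xs + sumMap f ys
sumMap-++ f xs ys = trans (cong sum (map-++ f xs ys)) (sum-++ (map f xs) (map f ys))

sumMap-↭ : ∀ (f : A → ℕ) {xs ys} → xs ↭ ys → sumMap f xs ≡ sumMap f ys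
sumMap-↭ f p = sum-↭ (map⁺ f p)

sumMap-∷ʳ-++ : ∀ (f : A → ℕ) xs x ys → sumMap f ((xs ∷ʳ x) ++ ys) ≡ sumMap f xs + f x + sumMap f ys
sumMap-∷ʳ-++ f xs x ys rewrite sumMap-++ f (xs ∷ʳ x) ys | sumMap-++ f xs (x ∷ []) | +-identityʳ (f x) = refl

length-∷ʳ-++ : ∀ (xs : List A) x ys → length ((xs ∷ʳ x) ++ ys) ≡ length ys + (length xs + 1)
length-∷ʳ-++ xs x ys rewrite length-++ (xs ∷ʳ x) {ys} | length-++ xs {x ∷ []} = +-comm (length xs + 1) (length ys)

<ᵇ-true : ∀ {m k} → m < k → (m <ᵇ k) ≡ true
<ᵇ-true {m} {k} m<k with m <ᵇ k | <⇒<ᵇ m<k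
... | true | _ = refl

<ᵇ-false : ∀ {m k} → k ≤ m → (m <ᵇ k) ≡ false
<ᵇ-false {m} {k} k≤m with m <ᵇ k in eq
... | false = refl
... | true = contradiction k≤m (<⇒≱ (<ᵇ⇒< m k (subst T (sym eq) tt)))

<ᵇ-true⁻¹ : ∀ {m k} → (m <ᵇ k) ≡ true → m < k
<ᵇ-true⁻¹ {m} {k} eq = <ᵇ⇒< m k (subst T (sym eq) tt)

<ᵇ-false⁻¹ : ∀ {m k} → (m <ᵇ k) ≡ false → k ≤ m
<ᵇ-false⁻¹ eq = ≮⇒≥ (λ m<k → subst T eq (<⇒<ᵇ m<k))

[+p]-[+r]≡[+q]-[+s] : ∀ p q r s → p + s ≡ q + r → ℤ.+ p ℤ.- ℤ.+ r ≡ ℤ.+ q ℤ.- ℤ.+ s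
[+p]-[+r]≡[+q]-[+s] p q r s p+s≡q+r = begin
  ℤ.+ p ℤ.- ℤ.+ r    ≡⟨ [+m]-[+n]≡m⊖n p r ⟩
  p ⊖ r              ≡⟨ +-cancelˡ-⊖ s p r ⟨
  (s + p) ⊖ (s + r)  ≡⟨ cong₂ _⊖_ (trans (+-comm s p) p+s≡q+r) (+-comm s r) ⟩
  (q + r) ⊖ (r + s)  ≡⟨ cong (_⊖ (r + s)) (+-comm q r) ⟩
  (r + q) ⊖ (r + s)  ≡⟨ +-cancelˡ-⊖ r q s ⟩
  q ⊖ s              ≡⟨ [+m]-[+n]≡m⊖n q s ⟨
  ℤ.+ q ℤ.- ℤ.+ s    ∎
  where open ≡-Reasoning

∷ʳ-≡-++-∷ : ∀ (u : List A) m a c b → u ∷ʳ m ≡ a ++ c ∷ b →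
             (b ≡ [] × c ≡ m × a ≡ u) ⊎ Σ[ b′ ∈ List A ] b ≡ b′ ∷ʳ m × u ≡ a ++ c ∷ b′
∷ʳ-≡-++-∷ u m a c b eq with initLast b
... | [] with ∷ʳ-injective u a eq
...   | refl , refl = inj₁ (refl , refl , refl)
∷ʳ-≡-++-∷ u m a c .(b′ ∷ʳ y) eq | b′ ∷ʳ′ y
  with ∷ʳ-injective u (a ++ c ∷ b′) (trans eq (sym (++-assoc a (c ∷ b′) (y ∷ []))))
... | refl , refl = inj₂ (b′ , refl , refl)

module FirstSplit (P : A → Bool) where

  None : List A → Set
  None = All (λ x → P x ≡ false)

  splitFirst : List A → Maybe (List A × A × List A)
  splitFirst [] = nothing
  splitFirst (x ∷ xs) = if P x then just ([] , x , xs) else Maybe.map (map₁ (x ∷_)) (splitFirst xs)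

  splitFirst-complete : ∀ a {c} b → None a → P c ≡ true → splitFirst (a ++ c ∷ b) ≡ just (a , c , b)
  splitFirst-complete [] b _ pc rewrite pc = refl
  splitFirst-complete (x ∷ a) b (px ∷ na) pc rewrite px | splitFirst-complete a b na pc = refl

  splitFirst-none : ∀ xs → None xs → splitFirst xs ≡ nothing
  splitFirst-none [] _ = refl
  splitFirst-none (x ∷ xs) (px ∷ na) rewrite px | splitFirst-none xs na = refl

  splitFirst-sound : ∀ xs {a c b} → splitFirst xs ≡ just (a , c , b) → xs ≡ a ++ c ∷ b × None a × P c ≡ true
  splitFirst-sound (x ∷ xs) eq with P x in px | splitFirst xs in e
  splitFirst-sound (x ∷ xs) refl | true | _ = refl , [] , px
  splitFirst-sound (x ∷ xs) refl | false | just _ with splitFirst-sound xs e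
  ... | xs≡ , na , pc = cong (x ∷_) xs≡ , px ∷ na , pc

  splitFirst-nothing : ∀ xs → splitFirst xs ≡ nothing → None xs
  splitFirst-nothing [] _ = []
  splitFirst-nothing (x ∷ xs) eq with P x in px | splitFirst xs in e
  splitFirst-nothing (x ∷ xs) refl | false | nothing = px ∷ splitFirst-nothing xs e

  splitFirst-++ʳ : ∀ xs ys {a c b} → splitFirst xs ≡ just (a , c , b) → splitFirst (xs ++ ys) ≡ just (a , c , b ++ ys)
  splitFirst-++ʳ xs ys {a} {c} {b} eq with splitFirst-sound xs eq
  ... | refl , na , pc rewrite ++-assoc a (c ∷ b) ys = splitFirst-complete a (b ++ ys) na pc

  splitFirst-++ˡ : ∀ xs ys → None xs → splitFirst (xs ++ ys) ≡ Maybe.map (map₁ (xs ++_)) (splitFirst ys)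
  splitFirst-++ˡ [] ys _ with splitFirst ys
  ... | nothing = refl
  ... | just _ = refl
  splitFirst-++ˡ (x ∷ xs) ys (px ∷ na) rewrite px | splitFirst-++ˡ xs ys na with splitFirst ys
  ... | nothing = refl
  ... | just _ = refl

  scan-first : ∀ {B : Set} (f : List A → B) (F : A → B) → (∀ x xs → f (x ∷ xs) ≡ (if P x then F x else f xs)) →
               ∀ xs {pre c post} → splitFirst xs ≡ just (pre , c , post) → f xs ≡ F c
  scan-first f F step xs {c = c} {post} eq with splitFirst-sound xs eq
  ... | refl , none , pc = go _ none
    where
    go : ∀ pre → None pre → f (pre ++ c ∷ post) ≡ F c
    go [] _ = trans (step c post) (cong (λ b → if b then F c else f post) pc)
    go (x ∷ pre) (px ∷ none) =
      trans (step x (pre ++ c ∷ post)) (trans (cong (λ b → if b then F x else f (pre ++ c ∷ post)) px) (go pre none))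

module MinimumRotation (key : A → ℕ) where

  IsFirstMin : List A → List A × A × List A → Set
  IsFirstMin xs (p , m , q) = xs ≡ p ++ m ∷ q × All (λ e → key m < key e) p × All (λ e → key m ≤ key e) q

  minSplit : A → List A → List A × A × List A
  minSplit x [] = [] , x , []
  minSplit x (y ∷ ys) with minSplit y ys
  ... | p , m , q = if key m <ᵇ key x then (x ∷ p , m , q) else ([] , x , y ∷ ys)

  minSplit-isFirstMin : ∀ x xs → IsFirstMin (x ∷ xs) (minSplit x xs)
  minSplit-isFirstMin x [] = refl , [] , []
  minSplit-isFirstMin x (y ∷ ys) with minSplit y ys | minSplit-isFirstMin y ys
  ... | p , m , q | ys≡ , m<p , m≤q with key m <ᵇ key x in m<x
  ...   | true = cong (x ∷_) ys≡ , <ᵇ-true⁻¹ m<x ∷ m<p , m≤q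
  ...   | false = refl , [] , subst (All (λ e → key x ≤ key e)) (sym ys≡)
                    (All.++⁺ (All.map (λ m<e → ≤-trans x≤m (<⇒≤ m<e)) m<p) (x≤m ∷ All.map (≤-trans x≤m) m≤q))
    where x≤m = <ᵇ-false⁻¹ m<x

  minSplit-unique : ∀ x xs {p m q} → IsFirstMin (x ∷ xs) (p , m , q) → minSplit x xs ≡ (p , m , q)
  minSplit-unique x [] {[]} (refl , _ , _) = refl
  minSplit-unique x [] {_ ∷ []} (() , _ , _)
  minSplit-unique x [] {_ ∷ _ ∷ _} (() , _ , _)
  minSplit-unique x (y ∷ ys) {[]} (refl , [] , x≤ys) with minSplit y ys | minSplit-isFirstMin y ys
  ... | p , m , q | ys≡ , _ , _ rewrite <ᵇ-false (All.head (All.++⁻ʳ p (subst (All (λ e → key x ≤ key e)) ys≡ x≤ys))) = refl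
  minSplit-unique x (y ∷ ys) {_ ∷ p} (eq , m<x ∷ m<p , m≤q) with ∷-injective eq
  ... | refl , ys≡ rewrite minSplit-unique y ys (ys≡ , m<p , m≤q) | <ᵇ-true m<x = refl

  rotate : List A × A × List A → List A × A
  rotate (p , m , q) = q ++ p , m

  rotateToMin : List⁺ A → List A × A
  rotateToMin (x ∷ xs) = rotate (minSplit x xs)

  rotateToMin-isFirstMin : ∀ xs → Σ[ t ∈ List A × A × List A ] rotateToMin xs ≡ rotate t × IsFirstMin (toList xs) t
  rotateToMin-isFirstMin (x ∷ xs) = minSplit x xs , refl , minSplit-isFirstMin x xs

  rotateToMin-unique : ∀ xs {t} → IsFirstMin (toList xs) t → rotateToMin xs ≡ rotate t
  rotateToMin-unique (x ∷ xs) isMin = cong rotate (minSplit-unique x xs isMin)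

module _ {n : ℕ} where

  δ : Fin n → Fin n → ℕ
  δ i j = if ⌊ i ≟ j ⌋ then 1 else 0

  δ-refl : ∀ i → δ i i ≡ 1
  δ-refl i with i ≟ i
  ... | yes _ = refl
  ... | no i≢i = contradiction refl i≢i

  δ-≢ : ∀ {i j} → i ≢ j → δ i j ≡ 0
  δ-≢ {i} {j} i≢j with i ≟ j
  ... | yes i≡j = contradiction i≡j i≢j
  ... | no _ = refl

  PTree-ind : (Q : PTree n → Set) → (∀ v cs → (∀ {c} → c ∈ cs → Q c) → Q (node v cs)) → ∀ t → Q t
  PTree-ind Q step (node v cs) = step v cs (children cs)
    where
    children : ∀ cs {c} → c ∈ cs → Q c
    children (c ∷ _) (here refl) = PTree-ind Q step c
    children (_ ∷ cs) (there c∈cs) = children cs c∈cs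

  count : Fin n → PTree n → ℕ
  count i t = occ i (labels t)

  occ-++ : ∀ i (xs ys : List (Fin n)) → occ i (xs ++ ys) ≡ occ i xs + occ i ys
  occ-++ i [] ys = refl
  occ-++ i (x ∷ xs) ys rewrite occ-++ i xs ys = sym (+-assoc (δ i x) _ _)

  occ-labelsF : ∀ i ts → occ i (labelsF ts) ≡ sumMap (count i) ts
  occ-labelsF i [] = refl
  occ-labelsF i (t ∷ ts) rewrite occ-++ i (labels t) (labelsF ts) = cong (count i t +_) (occ-labelsF i ts)

  count-node : ∀ i v ts → count i (node v ts) ≡ δ i v + sumMap (count i) ts
  count-node i v ts = cong (δ i v +_) (occ-labelsF i ts)

  count-node-≢ : ∀ {i v} ts → i ≢ v → count i (node v ts) ≡ sumMap (count i) ts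
  count-node-≢ {i} {v} ts i≢v = trans (count-node i v ts) (cong (_+ sumMap (count i) ts) (δ-≢ i≢v))

  count-children≤ : ∀ i v ts → sumMap (count i) ts ≤ count i (node v ts)
  count-children≤ i v ts = ≤-trans (m≤n+m _ (δ i v)) (≤-reflexive (sym (count-node i v ts)))

  count-root : ∀ v ts → 1 ≤ count v (node v ts)
  count-root v ts rewrite count-node v v ts | δ-refl v = s≤s z≤n

  mutual
    β-isLabel : ∀ t → Σ[ j ∈ Fin n ] toℕ j ≡ β t × 1 ≤ count j t
    β-isLabel (node v ts) with βF-isLabel (toℕ v) ts
    ... | inj₁ βF≡v = v , sym βF≡v , count-root v ts
    ... | inj₂ (j , j≡β , 1≤j) = j , j≡β , ≤-trans 1≤j (count-children≤ j v ts)

    βF-isLabel : ∀ m ts → βF m ts ≡ m ⊎ Σ[ j ∈ Fin n ] toℕ j ≡ βF m ts × 1 ≤ sumMap (count j) ts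
    βF-isLabel m [] = inj₁ refl
    βF-isLabel m (t ∷ ts) with βF-isLabel (m ⊓ β t) ts
    ... | inj₂ (j , j≡β , 1≤j) = inj₂ (j , j≡β , ≤-trans 1≤j (m≤n+m _ _))
    ... | inj₁ βF≡ with ⊓-sel m (β t) | β-isLabel t
    ...   | inj₁ ⊓≡m | _ = inj₁ (trans βF≡ ⊓≡m)
    ...   | inj₂ ⊓≡β | j , j≡β , 1≤j = inj₂ (j , trans j≡β (sym (trans βF≡ ⊓≡β)) , ≤-trans 1≤j (m≤m+n _ _))

  -- A record rather than a function, so that Distinct ts determines ts during unification.
  record Distinct (ts : List (PTree n)) : Set where
    constructor distinct
    field atMostOnce : ∀ i → sumMap (count i) ts ≤ 1
  open Distinct

  Distinct-≤ : ∀ {xs ys} → (∀ i → sumMap (count i) xs ≤ sumMap (count i) ys) → Distinct ys → Distinct xs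
  Distinct-≤ xs≤ys d = distinct λ i → ≤-trans (xs≤ys i) (atMostOnce d i)

  Distinct-↭ : ∀ {xs ys} → xs ↭ ys → Distinct ys → Distinct xs
  Distinct-↭ xs↭ys = Distinct-≤ (λ i → ≤-reflexive (sumMap-↭ (count i) xs↭ys))

  Distinct-++⁻ʳ : ∀ xs {ys} → Distinct (xs ++ ys) → Distinct ys
  Distinct-++⁻ʳ xs {ys} = Distinct-≤ (λ i → ≤-trans (m≤n+m _ _) (≤-reflexive (sym (sumMap-++ (count i) xs ys))))

  Distinct-children : ∀ {v ts rest} → Distinct (node v ts ∷ rest) → Distinct ts
  Distinct-children {v} {ts} = Distinct-≤ λ i → ≤-trans (count-children≤ i v ts) (m≤m+n _ _)

  Distinct-elsewhere : ∀ {i T H K} → 1 ≤ count i H → Distinct (T ∷ H ∷ K) → count i T ≡ 0 × sumMap (count i) K ≡ 0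
  Distinct-elsewhere {i} {T} {H} {K} 1≤H d = go (count i T) (count i H) (sumMap (count i) K) 1≤H (atMostOnce d i)
    where
    go : ∀ x y z → 1 ≤ y → x + (y + z) ≤ 1 → x ≡ 0 × z ≡ 0
    go zero (suc y) z _ (s≤s y+z≤0) = refl , m+n≡0⇒n≡0 y (n≤0⇒n≡0 y+z≤0)
    go (suc x) (suc y) z _ (s≤s x+y+z≤0) = contradiction (n≤0⇒n≡0 x+y+z≤0) (>⇒≢ (≤-trans (s≤s z≤n) (m≤n+m _ x)))

  β-distinct : ∀ {s t} → Distinct (s ∷ t ∷ []) → β s ≢ β t
  β-distinct {s} {t} d βs≡βt with β-isLabel s | β-isLabel t
  ... | j , j≡βs , 1≤j | k , k≡βt , 1≤k with toℕ-injective (trans j≡βs (trans βs≡βt (sym k≡βt)))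
  ... | refl = <⇒≱ (+-mono-≤ 1≤j (≤-trans 1≤k (m≤m+n _ 0))) (atMostOnce d j)

  β-fresh : ∀ {t ts} → Distinct (t ∷ ts) → All (λ e → β t ≢ β e) ts
  β-fresh {ts = []} d = []
  β-fresh {t} {e ∷ ts} d =
    β-distinct {t} {e} (Distinct-≤ (λ i → +-monoʳ-≤ (count i t) (+-monoʳ-≤ (count i e) z≤n)) d)
    ∷ β-fresh {t} {ts} (Distinct-≤ (λ i → +-monoʳ-≤ (count i t) (m≤n+m _ (count i e))) d)

  someSmaller-sound : ∀ {c b} (ts : List (PTree n)) → All (λ e → c ≤ β e) ts → someSmaller b ts ≡ true → c < b
  someSmaller-sound {b = b} (t ∷ ts) (c≤t ∷ c≤ts) eq with β t <ᵇ b in βt<b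
  ... | true = ≤-<-trans c≤t (<ᵇ-true⁻¹ βt<b)
  ... | false = someSmaller-sound ts c≤ts eq

  someSmaller-false⁻¹ : ∀ {b} (ts : List (PTree n)) → someSmaller b ts ≡ false → All (λ e → b ≤ β e) ts
  someSmaller-false⁻¹ [] _ = []
  someSmaller-false⁻¹ {b} (t ∷ ts) eq with β t <ᵇ b in βt<b
  ... | false = <ᵇ-false⁻¹ βt<b ∷ someSmaller-false⁻¹ ts eq

  someSmaller-false : ∀ {b} (ts : List (PTree n)) → All (λ e → b ≤ β e) ts → someSmaller b ts ≡ false
  someSmaller-false [] _ = refl
  someSmaller-false {b} (t ∷ ts) (b≤t ∷ b≤ts) rewrite <ᵇ-false {β t} {b} b≤t = someSmaller-false ts b≤ts

  someSmaller-true : ∀ {b} (xs : List (PTree n)) m ys → β m < b → someSmaller b (xs ++ m ∷ ys) ≡ true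
  someSmaller-true [] m ys m<b rewrite <ᵇ-true m<b = refl
  someSmaller-true {b} (x ∷ xs) m ys m<b rewrite someSmaller-true xs m ys m<b = ∨-zeroʳ (β x <ᵇ b)

  -- (u , m) is the segment u ∷ʳ m whose younger child m closes the elder children u.  A younger
  -- child has no smaller sibling to its right, which makes the segments of a vertex Canonical.
  Segment : Set
  Segment = List (PTree n) × PTree n

  members : Segment → List (PTree n)
  members (u , m) = u ∷ʳ m

  key : Segment → ℕ
  key (_ , m) = β m

  SegmentOK : Segment → Set
  SegmentOK (u , m) = All (λ e → β m < β e) u

  flatten : List Segment → List (PTree n)
  flatten [] = []
  flatten ((u , m) ∷ S) = u ++ m ∷ flatten S

  flatten-∷ : ∀ K S → flatten (K ∷ S) ≡ members K ++ flatten S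
  flatten-∷ (u , m) S = sym (++-assoc u (m ∷ []) (flatten S))

  flatten-++ : ∀ S S′ → flatten (S ++ S′) ≡ flatten S ++ flatten S′
  flatten-++ [] S′ = refl
  flatten-++ ((u , m) ∷ S) S′ rewrite flatten-++ S S′ = sym (++-assoc u (m ∷ flatten S) (flatten S′))

  flatten-middle : ∀ S₁ K S₂ → flatten (S₁ ++ K ∷ S₂) ↭ members K ++ flatten (S₁ ++ S₂)
  flatten-middle S₁ K S₂ rewrite flatten-++ S₁ (K ∷ S₂) | flatten-∷ K S₂ | flatten-++ S₁ S₂ =
    shifts (flatten S₁) (members K)

  All-flatten⁻ : ∀ {P : PTree n → Set} S → All P (flatten S) → All (λ K → P (proj₂ K)) S
  All-flatten⁻ [] _ = []
  All-flatten⁻ ((u , m) ∷ S) p with All.++⁻ʳ u p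
  ... | pm ∷ pS = pm ∷ All-flatten⁻ S pS

  Canonical : List Segment → Set
  Canonical [] = ⊤
  Canonical ((u , m) ∷ S) = SegmentOK (u , m) × All (λ e → β m ≤ β e) (flatten S) × Canonical S

  -- The second clause is unreachable: an elder child has a sibling to its right.
  attach : Bool → PTree n → List Segment → List Segment
  attach true t ((u , m) ∷ S) = (t ∷ u , m) ∷ S
  attach true t [] = ([] , t) ∷ []
  attach false t S = ([] , t) ∷ S

  segments : List (PTree n) → List Segment
  segments [] = []
  segments (t ∷ ts) = attach (someSmaller (β t) ts) t (segments ts)

  flatten-segments : ∀ ts → flatten (segments ts) ≡ ts
  flatten-segments [] = refl
  flatten-segments (t ∷ ts) with someSmaller (β t) ts | segments ts | flatten-segments ts
  ... | true | (u , m) ∷ S | eq = cong (t ∷_) eq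
  ... | true | [] | eq = cong (t ∷_) eq
  ... | false | S | eq = cong (t ∷_) eq

  Canonical-head : ∀ u m S → Canonical ((u , m) ∷ S) → All (λ e → β m ≤ β e) (flatten ((u , m) ∷ S))
  Canonical-head u m S (m<u , m≤S , _) = All.++⁺ (All.map <⇒≤ m<u) (≤-refl ∷ m≤S)

  segments-canonical : ∀ ts → Canonical (segments ts)
  segments-canonical [] = tt
  segments-canonical (t ∷ ts) with someSmaller (β t) ts in smaller | segments ts in eq | segments-canonical ts | flatten-segments ts
  ... | false | S | can | refl = [] , someSmaller-false⁻¹ (flatten S) smaller , can
  ... | true | (u , m) ∷ S | can@(m<u , rest) | refl =
        someSmaller-sound (flatten ((u , m) ∷ S)) (Canonical-head u m S can) smaller ∷ m<u , rest
  ... | true | [] | _ | refl with () ← smaller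

  segments-flatten : ∀ S → Canonical S → segments (flatten S) ≡ S
  segments-flatten [] _ = refl
  segments-flatten ((u , m) ∷ S) (m<u , m≤S , can) = go u m<u
    where
    go : ∀ u′ → All (λ e → β m < β e) u′ → segments (u′ ++ m ∷ flatten S) ≡ (u′ , m) ∷ S
    go [] _ = cong₂ (λ b S′ → attach b m S′) (someSmaller-false (flatten S) m≤S) (segments-flatten S can)
    go (e ∷ u′) (m<e ∷ m<u′) = cong₂ (λ b S′ → attach b e S′) (someSmaller-true u′ m (flatten S) m<e) (go u′ m<u′)

  elderCount+length-segments : ∀ ts → elderCount ts + length (segments ts) ≡ length ts
  elderCount+length-segments [] = refl
  elderCount+length-segments (t ∷ ts) with someSmaller (β t) ts in smaller | segments ts | elderCount+length-segments ts | flatten-segments ts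
  ... | false | S | eq | _ = trans (+-suc (elderCount ts) (length S)) (cong suc eq)
  ... | true | (u , m) ∷ S | eq | _ = cong suc eq
  ... | true | [] | _ | refl with () ← smaller

  youngerCount-segments : ∀ ts → youngerCount ts ≡ length (segments ts)
  youngerCount-segments ts =
    trans (cong (_∸ elderCount ts) (sym (elderCount+length-segments ts))) (m+n∸m≡n (elderCount ts) _)

  elderCount+youngerCount : ∀ ts → elderCount ts + youngerCount ts ≡ length ts
  elderCount+youngerCount ts = trans (cong (elderCount ts +_) (youngerCount-segments ts)) (elderCount+length-segments ts)

  youngerCount-flatten : ∀ S → Canonical S → youngerCount (flatten S) ≡ length S
  youngerCount-flatten S can = trans (youngerCount-segments (flatten S)) (cong length (segments-flatten S can))

  elderCount-shift : ∀ xs ys k j → length xs ≡ length ys + (k + j) → youngerCount xs ≡ youngerCount ys + j →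
                     elderCount xs ≡ elderCount ys + k
  elderCount-shift xs ys k j lengths youngers = +-cancelʳ-≡ (youngerCount xs) _ _ (begin
    elderCount xs + youngerCount xs                  ≡⟨ elderCount+youngerCount xs ⟩
    length xs                                        ≡⟨ lengths ⟩
    length ys + (k + j)                              ≡⟨ cong (_+ (k + j)) (elderCount+youngerCount ys) ⟨
    elderCount ys + youngerCount ys + (k + j)        ≡⟨ rearrange (elderCount ys) (youngerCount ys) k j ⟩
    elderCount ys + k + (youngerCount ys + j)        ≡⟨ cong (elderCount ys + k +_) youngers ⟨
    elderCount ys + k + youngerCount xs              ∎)
    where
    open ≡-Reasoning
    rearrange : ∀ e y k j → e + y + (k + j) ≡ e + k + (y + j)
    rearrange = solve-∀

  insert : Segment → List Segment → List Segment
  insert K [] = K ∷ []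
  insert K (K′ ∷ S) = if key K′ <ᵇ key K then K′ ∷ insert K S else K ∷ K′ ∷ S

  insert-split : ∀ K S → Σ[ S₁ ∈ List Segment ] Σ[ S₂ ∈ List Segment ] insert K S ≡ S₁ ++ K ∷ S₂ × S ≡ S₁ ++ S₂
  insert-split K [] = [] , [] , refl , refl
  insert-split K (K′ ∷ S) with key K′ <ᵇ key K
  ... | true with insert-split K S
  ...   | S₁ , S₂ , eq₁ , eq₂ = K′ ∷ S₁ , S₂ , cong (K′ ∷_) eq₁ , cong (K′ ∷_) eq₂
  insert-split K (K′ ∷ S) | false = [] , K′ ∷ S , refl , refl

  insert-↭ : ∀ K S → insert K S ↭ K ∷ S
  insert-↭ K S with insert-split K S
  ... | S₁ , S₂ , eq₁ , eq₂ rewrite eq₁ | eq₂ = shift K S₁ S₂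

  flatten-insert : ∀ K S → flatten (insert K S) ↭ members K ++ flatten S
  flatten-insert K S with insert-split K S
  ... | S₁ , S₂ , eq₁ , eq₂ rewrite eq₁ | eq₂ = flatten-middle S₁ K S₂

  insert-canonical : ∀ K S → SegmentOK K → Canonical S → Canonical (insert K S)
  insert-canonical (u , m) [] ok _ = ok , [] , tt
  insert-canonical (u , m) ((u′ , m′) ∷ S) ok can@(m′<u′ , m′≤S , canS) with β m′ <ᵇ β m in m′<m?
  ... | true = m′<u′ , m′≤rest , insert-canonical (u , m) S ok canS
    where
    m′<m = <ᵇ-true⁻¹ m′<m?
    m′≤rest : All (λ e → β m′ ≤ β e) (flatten (insert (u , m) S))
    m′≤rest = All-resp-↭ (↭-sym (flatten-insert (u , m) S))
      (All.++⁺ (All.++⁺ (All.map (λ m<e → <⇒≤ (<-trans m′<m m<e)) ok) (<⇒≤ m′<m ∷ [])) m′≤S)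
  ... | false = ok , All.map (≤-trans (<ᵇ-false⁻¹ m′<m?)) (Canonical-head u′ m′ S can) , can

  insert-at : ∀ K S₁ S₂ → All (λ K′ → key K′ < key K) S₁ → All (λ K′ → key K ≤ key K′) S₂ →
              insert K (S₁ ++ S₂) ≡ S₁ ++ K ∷ S₂
  insert-at K [] [] _ _ = refl
  insert-at K [] (K′ ∷ S₂) _ (K≤K′ ∷ _) rewrite <ᵇ-false {key K′} {key K} K≤K′ = refl
  insert-at K (K′ ∷ S₁) S₂ (K′<K ∷ S₁<K) K≤S₂ rewrite <ᵇ-true K′<K = cong (K′ ∷_) (insert-at K S₁ S₂ S₁<K K≤S₂)

  Canonical-position : ∀ S₁ u m S₂ → Canonical (S₁ ++ (u , m) ∷ S₂) → Distinct (flatten (S₁ ++ (u , m) ∷ S₂)) →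
                       All (λ K′ → key K′ < β m) S₁ × All (λ K′ → β m ≤ key K′) S₂
  Canonical-position [] u m S₂ (_ , m≤S₂ , _) _ = [] , All-flatten⁻ S₂ m≤S₂
  Canonical-position ((u′ , m′) ∷ S₁) u m S₂ (_ , m′≤rest , can) d
    with Canonical-position S₁ u m S₂ can (Distinct-++⁻ʳ (m′ ∷ []) (Distinct-++⁻ʳ u′ d))
  ... | S₁<m , m≤S₂ = All.head (All.++⁻ʳ S₁ (All-flatten⁻ (S₁ ++ (u , m) ∷ S₂) m′<rest)) ∷ S₁<m , m≤S₂
    where m′<rest = All.zipWith (uncurry ≤∧≢⇒<) (m′≤rest , β-fresh (Distinct-++⁻ʳ u′ d))

  open MinimumRotation (β {n}) using (IsFirstMin; rotate; rotateToMin; rotateToMin-isFirstMin; rotateToMin-unique)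

  -- For distinct labels, the only rotation of w ∷ʳ X that is a well-formed segment.
  segmentFrom : List (PTree n) → PTree n → Segment
  segmentFrom w X = rotateToMin (w ⁺∷ʳ X)

  toList-⁺∷ʳ : ∀ (w : List (PTree n)) X → toList (w ⁺∷ʳ X) ≡ w ∷ʳ X
  toList-⁺∷ʳ [] X = refl
  toList-⁺∷ʳ (x ∷ w) X = refl

  segmentFrom-isFirstMin : ∀ w X → Σ[ t ∈ List (PTree n) × PTree n × List (PTree n) ]
                           segmentFrom w X ≡ rotate t × IsFirstMin (w ∷ʳ X) t
  segmentFrom-isFirstMin w X with rotateToMin-isFirstMin (w ⁺∷ʳ X)
  ... | t , eq , isMin rewrite toList-⁺∷ʳ w X = t , eq , isMin

  segmentFrom-unique : ∀ w X {t} → IsFirstMin (w ∷ʳ X) t → segmentFrom w X ≡ rotate t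
  segmentFrom-unique w X isMin = rotateToMin-unique (w ⁺∷ʳ X) (subst (λ xs → IsFirstMin xs _) (sym (toList-⁺∷ʳ w X)) isMin)

  members-segmentFrom : ∀ w X → members (segmentFrom w X) ↭ w ∷ʳ X
  members-segmentFrom w X with segmentFrom-isFirstMin w X
  ... | (p , m , q) , eq , w∷ʳX≡ , _ = begin
    members (segmentFrom w X)  ≡⟨ cong members eq ⟩
    (q ++ p) ∷ʳ m              ≡⟨ ++-assoc q p (m ∷ []) ⟩
    q ++ p ∷ʳ m                ↭⟨ ++-comm q (p ∷ʳ m) ⟩
    (p ∷ʳ m) ++ q              ≡⟨ ++-assoc p (m ∷ []) q ⟩
    p ++ m ∷ q                 ≡⟨ w∷ʳX≡ ⟨
    w ∷ʳ X                     ∎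
    where open PermutationReasoning

  segmentFrom-OK : ∀ w X → Distinct (w ∷ʳ X) → SegmentOK (segmentFrom w X)
  segmentFrom-OK w X d with segmentFrom-isFirstMin w X
  ... | (p , m , q) , eq , w∷ʳX≡ , m<p , m≤q = subst SegmentOK (sym eq) $
    All.++⁺ (All.zipWith (uncurry ≤∧≢⇒<) (m≤q , β-fresh (Distinct-++⁻ʳ p (subst Distinct w∷ʳX≡ d)))) m<p

  segmentFrom-restore : ∀ {u m} a c b → SegmentOK (u , m) → u ∷ʳ m ≡ a ++ c ∷ b → segmentFrom (b ++ a) c ≡ (u , m)
  segmentFrom-restore {u} {m} a c b m<u eq with ∷ʳ-≡-++-∷ u m a c b eq
  ... | inj₁ (refl , refl , refl) = segmentFrom-unique u m (refl , m<u , [])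
  ... | inj₂ (b′ , refl , refl) = trans (segmentFrom-unique ((b′ ∷ʳ m) ++ a) c (rotation , m<b′ , m≤a∷ʳc))
                                        (cong (_, m) (++-assoc a (c ∷ []) b′))
    where
    rotation : ((b′ ∷ʳ m) ++ a) ∷ʳ c ≡ b′ ++ m ∷ a ∷ʳ c
    rotation = trans (++-assoc (b′ ∷ʳ m) a (c ∷ [])) (++-assoc b′ (m ∷ []) (a ∷ʳ c))
    m<b′ = All.++⁻ʳ (a ∷ʳ c) (subst (All (λ e → β m < β e)) (sym (++-assoc a (c ∷ []) b′)) m<u)
    m≤a∷ʳc = All.map <⇒≤ (All.++⁻ˡ (a ∷ʳ c) (subst (All (λ e → β m < β e)) (sym (++-assoc a (c ∷ []) b′)) m<u))

  Canonical-remove : ∀ S₁ K S₂ → Canonical (S₁ ++ K ∷ S₂) → Canonical (S₁ ++ S₂)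
  Canonical-remove [] (u , m) S₂ (_ , _ , can) = can
  Canonical-remove ((u′ , m′) ∷ S₁) K S₂ (m′<u′ , m′≤rest , can) =
    m′<u′ , All.++⁻ʳ (members K) (All-resp-↭ (flatten-middle S₁ K S₂) m′≤rest) , Canonical-remove S₁ K S₂ can

  Canonical-middle : ∀ S₁ K S₂ → Canonical (S₁ ++ K ∷ S₂) → SegmentOK K
  Canonical-middle [] (u , m) S₂ (ok , _) = ok
  Canonical-middle ((u′ , m′) ∷ S₁) K S₂ (_ , _ , can) = Canonical-middle S₁ K S₂ can

  graft : List (PTree n) → PTree n → List Segment → List (PTree n)
  graft w X S = flatten (insert (segmentFrom w X) S)

  graft-↭ : ∀ w X S → graft w X S ↭ (w ∷ʳ X) ++ flatten S
  graft-↭ w X S = ↭-trans (flatten-insert (segmentFrom w X) S) (++⁺ʳ (flatten S) (members-segmentFrom w X))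

  segments-graft : ∀ w X S → Distinct (w ∷ʳ X) → Canonical S → segments (graft w X S) ≡ insert (segmentFrom w X) S
  segments-graft w X S d can = segments-flatten _ (insert-canonical (segmentFrom w X) S (segmentFrom-OK w X d) can)

  youngerCount-graft : ∀ w X S → Distinct (w ∷ʳ X) → Canonical S → youngerCount (graft w X S) ≡ suc (length S)
  youngerCount-graft w X S d can =
    trans (youngerCount-segments (graft w X S)) (trans (cong length (segments-graft w X S d can)) (↭-length (insert-↭ _ S)))

  sumMap-graft : ∀ f w X S → sumMap f (graft w X S) ≡ sumMap f w + f X + sumMap f (flatten S)
  sumMap-graft f w X S = trans (sumMap-↭ f (graft-↭ w X S)) (sumMap-∷ʳ-++ f w X (flatten S))

  elderCount-graft : ∀ w X S → Distinct (w ∷ʳ X) → Canonical S → elderCount (graft w X S) ≡ elderCount (flatten S) + length w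
  elderCount-graft w X S d can = elderCount-shift (graft w X S) (flatten S) (length w) 1
    (trans (↭-length (graft-↭ w X S)) (length-∷ʳ-++ w X (flatten S)))
    (trans (youngerCount-graft w X S d can) (trans (+-comm 1 (length S)) (cong (_+ 1) (sym (youngerCount-flatten S can)))))

  module Extraction (P : PTree n → Bool) where
    open FirstSplit P public

    -- Removes the first segment containing a P-child c and returns the other members of that
    -- segment, listed cyclically from just after c.
    extract : List Segment → List Segment × List (PTree n)
    extract [] = [] , []
    extract (K ∷ S) with splitFirst (members K)
    ... | just (a , _ , b) = S , b ++ a
    ... | nothing = map₁ (K ∷_) (extract S)

    None-flatten-∷ : ∀ K S → None (flatten (K ∷ S)) → None (members K) × None (flatten S)
    None-flatten-∷ K S none = All.++⁻ (members K) (subst None (flatten-∷ K S) none)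

    extract-at : ∀ S₁ K S₂ {a c b} → None (flatten S₁) → splitFirst (members K) ≡ just (a , c , b) →
                 extract (S₁ ++ K ∷ S₂) ≡ (S₁ ++ S₂ , b ++ a)
    extract-at [] K S₂ _ eq rewrite eq = refl
    extract-at (K′ ∷ S₁) K S₂ none eq with None-flatten-∷ K′ S₁ none
    ... | noneK′ , noneS₁ rewrite splitFirst-none (members K′) noneK′ | extract-at S₁ K S₂ noneS₁ eq = refl

    locate : ∀ S {pre c post} → splitFirst (flatten S) ≡ just (pre , c , post) →
      Σ[ S₁ ∈ List Segment ] Σ[ K ∈ Segment ] Σ[ S₂ ∈ List Segment ] Σ[ a ∈ List (PTree n) ] Σ[ b ∈ List (PTree n) ]
        S ≡ S₁ ++ K ∷ S₂ × None (flatten S₁) × splitFirst (members K) ≡ just (a , c , b)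
    locate (K ∷ S) eq rewrite flatten-∷ K S with splitFirst (members K) in eqK
    ... | just (a , c , b) with trans (sym (splitFirst-++ʳ (members K) (flatten S) eqK)) eq
    ...   | refl = [] , K , S , a , b , refl , [] , eqK
    locate (K ∷ S) eq | nothing
      with splitFirst (flatten S) in eqS | trans (sym (splitFirst-++ˡ (members K) (flatten S) (splitFirst-nothing (members K) eqK))) eq
    ... | just _ | refl with locate S eqS
    ...   | S₁ , K′ , S₂ , a , b , refl , noneS₁ , eqK′ =
            K ∷ S₁ , K′ , S₂ , a , b , refl ,
            subst None (sym (flatten-∷ K S₁)) (All.++⁺ (splitFirst-nothing (members K) eqK) noneS₁) , eqK′

    kept : List (PTree n) → List Segment
    kept cs = proj₁ (extract (segments cs))

    loose : List (PTree n) → List (PTree n)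
    loose cs = proj₂ (extract (segments cs))

    record Extracted (cs : List (PTree n)) (c : PTree n) : Set where
      field
        S₁ S₂ : List Segment
        u a b : List (PTree n)
        m : PTree n
        segments≡ : segments cs ≡ S₁ ++ (u , m) ∷ S₂
        members≡ : u ∷ʳ m ≡ a ++ c ∷ b
        kept≡ : kept cs ≡ S₁ ++ S₂
        loose≡ : loose cs ≡ b ++ a

    extracted : ∀ cs {pre c post} → splitFirst cs ≡ just (pre , c , post) → Extracted cs c
    extracted cs eq with locate (segments cs) (trans (cong splitFirst (flatten-segments cs)) eq)
    ... | S₁ , (u , m) , S₂ , a , b , segments≡ , none , eqK = record
      { segments≡ = segments≡
      ; members≡ = proj₁ (splitFirst-sound (u ∷ʳ m) eqK)
      ; kept≡ = cong proj₁ extract≡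
      ; loose≡ = cong proj₂ extract≡
      }
      where extract≡ = trans (cong extract segments≡) (extract-at S₁ (u , m) S₂ none eqK)

    module _ cs {pre c post} (first : splitFirst cs ≡ just (pre , c , post)) where
      open Extracted (extracted cs first)

      children-↭ : cs ↭ (loose cs ∷ʳ c) ++ flatten (kept cs)
      children-↭ rewrite loose≡ | kept≡ = begin
        cs                                  ≡⟨ flatten-segments cs ⟨
        flatten (segments cs)               ≡⟨ cong flatten segments≡ ⟩
        flatten (S₁ ++ (u , m) ∷ S₂)        ↭⟨ flatten-middle S₁ (u , m) S₂ ⟩
        (u ∷ʳ m) ++ flatten (S₁ ++ S₂)      ≡⟨ cong (_++ flatten (S₁ ++ S₂)) members≡ ⟩
        (a ++ c ∷ b) ++ flatten (S₁ ++ S₂)  ↭⟨ ++⁺ʳ (flatten (S₁ ++ S₂)) rotation ⟩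
        ((b ++ a) ∷ʳ c) ++ flatten (S₁ ++ S₂) ∎
        where
        open PermutationReasoning
        rotation : a ++ c ∷ b ↭ (b ++ a) ∷ʳ c
        rotation = ↭-trans (shift c a b) (↭-trans (prep c (++-comm a b)) (∷↭∷ʳ c (b ++ a)))

      private
        canonical-segments′ : Canonical (S₁ ++ (u , m) ∷ S₂)
        canonical-segments′ = subst Canonical segments≡ (segments-canonical cs)

      kept-canonical : Canonical (kept cs)
      kept-canonical = subst Canonical (sym kept≡) (Canonical-remove S₁ (u , m) S₂ canonical-segments′)

      length-kept : length (segments cs) ≡ suc (length (kept cs))
      length-kept = trans (cong length segments≡) (trans (↭-length (shift (u , m) S₁ S₂)) (cong (suc ∘ length) (sym kept≡)))

      reinsert : Distinct cs → graft (loose cs) c (kept cs) ≡ cs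
      reinsert d rewrite loose≡ | kept≡ = begin
        flatten (insert (segmentFrom (b ++ a) c) (S₁ ++ S₂)) ≡⟨ cong (λ K → flatten (insert K (S₁ ++ S₂))) segment≡ ⟩
        flatten (insert (u , m) (S₁ ++ S₂))                  ≡⟨ cong flatten (insert-at (u , m) S₁ S₂ S₁<m m≤S₂) ⟩
        flatten (S₁ ++ (u , m) ∷ S₂)                         ≡⟨ cong flatten segments≡ ⟨
        flatten (segments cs)                                ≡⟨ flatten-segments cs ⟩
        cs                                                   ∎
        where
        open ≡-Reasoning
        segment≡ = segmentFrom-restore a c b (Canonical-middle S₁ (u , m) S₂ canonical-segments′) members≡
        position = Canonical-position S₁ u m S₂ canonical-segments′
                     (subst Distinct (sym (trans (cong flatten (sym segments≡)) (flatten-segments cs))) d)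
        S₁<m = proj₁ position
        m≤S₂ = proj₂ position

    segmentFrom-split : ∀ w X → None w → P X ≡ true →
      Σ[ a ∈ List (PTree n) ] Σ[ b ∈ List (PTree n) ] splitFirst (members (segmentFrom w X)) ≡ just (a , X , b) × b ++ a ≡ w
    segmentFrom-split w X none pX with segmentFrom-isFirstMin w X
    ... | (p , m , q) , eq , w∷ʳX≡ , _ with ∷ʳ-≡-++-∷ w X p m q w∷ʳX≡
    ...   | inj₁ (refl , refl , refl) = w , [] , trans (cong (splitFirst ∘ members) eq) (splitFirst-complete w [] none pX) , refl
    ...   | inj₂ (q′ , refl , refl) =
            q′ , p ∷ʳ m ,
            trans (cong (splitFirst ∘ members) eq) (trans (cong splitFirst rotation) (splitFirst-complete q′ (p ∷ʳ m) noneq′ pX)) ,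
            ++-assoc p (m ∷ []) q′
      where
      rotation : ((q′ ∷ʳ X) ++ p) ∷ʳ m ≡ q′ ++ X ∷ p ∷ʳ m
      rotation = trans (++-assoc (q′ ∷ʳ X) p (m ∷ [])) (++-assoc q′ (X ∷ []) (p ∷ʳ m))
      noneq′ = All.++⁻ʳ (p ∷ʳ m) (subst None (sym (++-assoc p (m ∷ []) q′)) none)

    None-flatten-++ˡ : ∀ S₁ S₂ → None (flatten (S₁ ++ S₂)) → None (flatten S₁)
    None-flatten-++ˡ S₁ S₂ none = All.++⁻ˡ (flatten S₁) (subst None (flatten-++ S₁ S₂) none)

    extract-insert : ∀ w X S → None w → P X ≡ true → None (flatten S) → extract (insert (segmentFrom w X) S) ≡ (S , w)
    extract-insert w X S noneW pX noneS with insert-split (segmentFrom w X) S | segmentFrom-split w X noneW pX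
    ... | S₁ , S₂ , insert≡ , refl | a , b , splitK , ba≡w =
      trans (cong extract insert≡)
            (trans (extract-at S₁ (segmentFrom w X) S₂ (None-flatten-++ˡ S₁ S₂ noneS) splitK) (cong (S₁ ++ S₂ ,_) ba≡w))

    splitFirst-graft : ∀ w X S → None w → P X ≡ true → None (flatten S) →
      Σ[ pre ∈ List (PTree n) ] Σ[ post ∈ List (PTree n) ] splitFirst (graft w X S) ≡ just (pre , X , post)
    splitFirst-graft w X S noneW pX noneS with insert-split (segmentFrom w X) S | segmentFrom-split w X noneW pX
    ... | S₁ , S₂ , insert≡ , refl | a , b , splitK , _ = flatten S₁ ++ a , b ++ flatten S₂ , (begin
      splitFirst (flatten (insert K (S₁ ++ S₂)))
        ≡⟨ cong (splitFirst ∘ flatten) insert≡ ⟩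
      splitFirst (flatten (S₁ ++ K ∷ S₂))
        ≡⟨ cong splitFirst (trans (flatten-++ S₁ (K ∷ S₂)) (cong (flatten S₁ ++_) (flatten-∷ K S₂))) ⟩
      splitFirst (flatten S₁ ++ members K ++ flatten S₂)
        ≡⟨ splitFirst-++ˡ (flatten S₁) _ (None-flatten-++ˡ S₁ S₂ noneS) ⟩
      Maybe.map (map₁ (flatten S₁ ++_)) (splitFirst (members K ++ flatten S₂))
        ≡⟨ cong (Maybe.map (map₁ (flatten S₁ ++_))) (splitFirst-++ʳ (members K) (flatten S₂) splitK) ⟩
      just (flatten S₁ ++ a , X , b ++ flatten S₂) ∎)
      where
      open ≡-Reasoning
      K = segmentFrom w X

    extract-graft : ∀ w X S → Distinct (w ∷ʳ X) → Canonical S → None w → P X ≡ true → None (flatten S) →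
                    extract (segments (graft w X S)) ≡ (S , w)
    extract-graft w X S d can noneW pX noneS =
      trans (cong extract (segments-graft w X S d can)) (extract-insert w X S noneW pX noneS)

  -- h v e y is the weight of a vertex v with e elder and y younger children.
  Statistic : Set
  Statistic = Fin n → ℕ → ℕ → ℕ

  mutual
    total : Statistic → PTree n → ℕ
    total h (node v ts) = h v (elderCount ts) (youngerCount ts) + totalF h ts

    totalF : Statistic → List (PTree n) → ℕ
    totalF h [] = 0
    totalF h (t ∷ ts) = total h t + totalF h ts

  totalF≡sumMap : ∀ h ts → totalF h ts ≡ sumMap (total h) ts
  totalF≡sumMap h [] = refl
  totalF≡sumMap h (t ∷ ts) = cong (total h t +_) (totalF≡sumMap h ts)

  total-node : ∀ h v ts → total h (node v ts) ≡ h v (elderCount ts) (youngerCount ts) + sumMap (total h) ts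
  total-node h v ts = cong (h v (elderCount ts) (youngerCount ts) +_) (totalF≡sumMap h ts)

  labelCount : Fin n → Statistic
  labelCount i v _ _ = δ i v

  elderStatistic : Statistic
  elderStatistic _ e _ = e

  youngerStatistic : Fin n → Statistic
  youngerStatistic i v _ y = if ⌊ i ≟ v ⌋ then y else 0

  mutual
    count≡total : ∀ i t → count i t ≡ total (labelCount i) t
    count≡total i (node v ts) = trans (count-node i v ts) (cong (δ i v +_) (countF≡totalF i ts))

    countF≡totalF : ∀ i ts → sumMap (count i) ts ≡ totalF (labelCount i) ts
    countF≡totalF i [] = refl
    countF≡totalF i (t ∷ ts) = cong₂ _+_ (count≡total i t) (countF≡totalF i ts)

  mutual
    eld≡total : ∀ t → eld t ≡ total elderStatistic t
    eld≡total (node v ts) = cong (elderCount ts +_) (eldF≡totalF ts)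

    eldF≡totalF : ∀ ts → eldF ts ≡ totalF elderStatistic ts
    eldF≡totalF [] = refl
    eldF≡totalF (t ∷ ts) = cong₂ _+_ (eld≡total t) (eldF≡totalF ts)

  mutual
    youngExp≡total : ∀ i t → youngExp t i ≡ total (youngerStatistic i) t
    youngExp≡total i (node v ts) = cong (youngerStatistic i v (elderCount ts) (youngerCount ts) +_) (youngExpF≡totalF i ts)

    youngExpF≡totalF : ∀ i ts → youngExpF ts i ≡ totalF (youngerStatistic i) ts
    youngExpF≡totalF i [] = refl
    youngExpF≡totalF i (t ∷ ts) = cong₂ _+_ (youngExp≡total i t) (youngExpF≡totalF i ts)

  contains : Fin n → PTree n → Bool
  contains g t = 1 ≤ᵇ count g t

  contains-true⁻¹ : ∀ g t → contains g t ≡ true → 1 ≤ count g t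
  contains-true⁻¹ g t eq = ≤ᵇ⇒≤ 1 (count g t) (subst T (sym eq) tt)

  contains-false⁻¹ : ∀ g t → contains g t ≡ false → count g t ≡ 0
  contains-false⁻¹ g t eq = n<1⇒n≡0 (≰⇒> (λ 1≤count → subst T eq (≤⇒≤ᵇ 1≤count)))

  contains-true : ∀ g t → 1 ≤ count g t → contains g t ≡ true
  contains-true g t 1≤count with contains g t in eq
  ... | true = refl
  ... | false = contradiction (contains-false⁻¹ g t eq) (>⇒≢ 1≤count)

  contains-none : ∀ g ts → sumMap (count g) ts ≡ 0 → FirstSplit.None (contains g) ts
  contains-none g [] _ = []
  contains-none g (t ∷ ts) eq with contains g t in c
  ... | false = c ∷ contains-none g ts (m+n≡0⇒n≡0 (count g t) eq)
  ... | true = contradiction (m+n≡0⇒m≡0 (count g t) eq) (>⇒≢ (contains-true⁻¹ g t c))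

  contains-none⁻¹ : ∀ g ts → FirstSplit.None (contains g) ts → sumMap (count g) ts ≡ 0
  contains-none⁻¹ g [] _ = refl
  contains-none⁻¹ g (t ∷ ts) (none ∷ nones) rewrite contains-false⁻¹ g t none = contains-none⁻¹ g ts nones

  module Reroot (g : Fin n) where
    open Extraction (contains g) public

    regraft : List (PTree n) → PTree n → List (PTree n)
    regraft cs H = graft (loose cs) H (kept cs)

    -- descend T H K walks down from T to the vertex g: H is the previous vertex of the path,
    -- already stripped and about to become a child of T, and K are the siblings left over at the
    -- old root, which join H in its new segment at g.  The first clause of descendInto is unreachable.
    mutual
      descend : PTree n → PTree n → List (PTree n) → PTree n
      descend (node w cs) H K = if ⌊ w ≟ g ⌋ then node g (graft K H (segments cs)) else descendInto w cs cs H K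

      descendInto : Fin n → List (PTree n) → List (PTree n) → PTree n → List (PTree n) → PTree n
      descendInto w cs [] H K = node w cs
      descendInto w cs (c ∷ xs) H K = if contains g c then descend c (node w (regraft cs H)) K else descendInto w cs xs H K

    rerootFrom : Fin n → List (PTree n) → List (PTree n) → PTree n
    rerootFrom v cs [] = node v cs
    rerootFrom v cs (c ∷ xs) = if contains g c then descend c (node v (flatten (kept cs))) (loose cs) else rerootFrom v cs xs

    reroot : PTree n → PTree n
    reroot (node v cs) = rerootFrom v cs cs

    descend-here : ∀ cs H K → descend (node g cs) H K ≡ node g (graft K H (segments cs))
    descend-here cs H K with g ≟ g
    ... | yes _ = refl
    ... | no g≢g = contradiction refl g≢g

    descend-there : ∀ {w} cs H K → w ≢ g → descend (node w cs) H K ≡ descendInto w cs cs H K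
    descend-there {w} cs H K w≢g with w ≟ g
    ... | yes w≡g = contradiction w≡g w≢g
    ... | no _ = refl

    descendInto-first : ∀ w cs xs H K {pre c post} → splitFirst xs ≡ just (pre , c , post) →
                        descendInto w cs xs H K ≡ descend c (node w (regraft cs H)) K
    descendInto-first w cs xs H K =
      scan-first (λ xs → descendInto w cs xs H K) (λ c → descend c (node w (regraft cs H)) K) (λ _ _ → refl) xs

    rerootFrom-first : ∀ v cs xs {pre c post} → splitFirst xs ≡ just (pre , c , post) →
                       rerootFrom v cs xs ≡ descend c (node v (flatten (kept cs))) (loose cs)
    rerootFrom-first v cs xs =
      scan-first (rerootFrom v cs) (λ c → descend c (node v (flatten (kept cs))) (loose cs)) (λ _ _ → refl) xs

    first-exists : ∀ xs → 1 ≤ sumMap (count g) xs → Σ[ pre ∈ List (PTree n) ] Σ[ c ∈ PTree n ] Σ[ post ∈ List (PTree n) ]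
                   splitFirst xs ≡ just (pre , c , post)
    first-exists xs 1≤count with splitFirst xs in eq
    ... | just (pre , c , post) = pre , c , post , refl
    ... | nothing = contradiction (contains-none⁻¹ g xs (splitFirst-nothing xs eq)) (>⇒≢ 1≤count)

    first-∈ : ∀ xs {pre c post} → splitFirst xs ≡ just (pre , c , post) → c ∈ xs
    first-∈ xs first with splitFirst-sound xs first
    ... | refl , _ = ∈-++⁺ʳ _ (here refl)

    first-contains : ∀ xs {pre c post} → splitFirst xs ≡ just (pre , c , post) → 1 ≤ count g c
    first-contains xs {c = c} first = contains-true⁻¹ g c (proj₂ (proj₂ (splitFirst-sound xs first)))

    sumMap-children : ∀ cs {pre c post} → splitFirst cs ≡ just (pre , c , post) →
                      ∀ f → sumMap f cs ≡ sumMap f (loose cs) + f c + sumMap f (flatten (kept cs))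
    sumMap-children cs {c = c} first f = trans (sumMap-↭ f (children-↭ cs first)) (sumMap-∷ʳ-++ f (loose cs) c (flatten (kept cs)))

    module _ cs {pre c post} (first : splitFirst cs ≡ just (pre , c , post)) {H} (d : Distinct (loose cs ∷ʳ H)) where

      youngerCount-regraft : youngerCount (regraft cs H) ≡ youngerCount cs
      youngerCount-regraft = trans (youngerCount-graft (loose cs) H (kept cs) d (kept-canonical cs first))
                                   (trans (sym (length-kept cs first)) (sym (youngerCount-segments cs)))

      elderCount-regraft : elderCount (regraft cs H) ≡ elderCount cs
      elderCount-regraft =
        trans (elderCount-shift (regraft cs H) cs 0 0 lengths (trans youngerCount-regraft (sym (+-identityʳ _)))) (+-identityʳ _)
        where
        F = flatten (kept cs)
        lengths : length (regraft cs H) ≡ length cs + 0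
        lengths = trans (↭-length (graft-↭ (loose cs) H (kept cs))) (trans (length-∷ʳ-++ (loose cs) H F)
                    (sym (trans (+-identityʳ _) (trans (↭-length (children-↭ cs first)) (length-∷ʳ-++ (loose cs) c F)))))

      total-regraft : ∀ w h → total h c + total h (node w (regraft cs H)) ≡ total h (node w cs) + total h H
      total-regraft w h = begin
        total h c + total h (node w R)
          ≡⟨ cong (total h c +_) (total-node h w R) ⟩
        total h c + (h w (elderCount R) (youngerCount R) + sumMap (total h) R)
          ≡⟨ cong₂ (λ a b → total h c + (h w a b + sumMap (total h) R)) elderCount-regraft youngerCount-regraft ⟩
        total h c + (h w e y + sumMap (total h) R)
          ≡⟨ cong (λ r → total h c + (h w e y + r)) (sumMap-graft (total h) (loose cs) H (kept cs)) ⟩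
        total h c + (h w e y + (sumMap (total h) (loose cs) + total h H + sumMap (total h) F))
          ≡⟨ rearrange (total h c) (h w e y) (sumMap (total h) (loose cs)) (total h H) (sumMap (total h) F) ⟩
        h w e y + (sumMap (total h) (loose cs) + total h c + sumMap (total h) F) + total h H
          ≡⟨ cong (λ r → h w e y + r + total h H) (sumMap-children cs first (total h)) ⟨
        h w e y + sumMap (total h) cs + total h H
          ≡⟨ cong (_+ total h H) (total-node h w cs) ⟨
        total h (node w cs) + total h H ∎
        where
        open ≡-Reasoning
        R = regraft cs H
        F = flatten (kept cs)
        e = elderCount cs
        y = youngerCount cs
        rearrange : ∀ c s l x f → c + (s + (l + x + f)) ≡ s + (l + c + f) + x
        rearrange = solve-∀

    Distinct-loose : ∀ w cs {pre c post} H K → splitFirst cs ≡ just (pre , c , post) →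
                     Distinct (node w cs ∷ H ∷ K) → Distinct (loose cs ∷ʳ H)
    Distinct-loose w cs {c = c} H K first = Distinct-≤ λ i → begin
      sumMap (count i) (loose cs ∷ʳ H)                        ≡⟨ sumMap-++ (count i) (loose cs) (H ∷ []) ⟩
      sumMap (count i) (loose cs) + (count i H + 0)           ≤⟨ +-mono-≤ (loose≤ i) (+-monoʳ-≤ (count i H) z≤n) ⟩
      count i (node w cs) + (count i H + sumMap (count i) K)  ∎
      where
      open ≤-Reasoning
      loose≤ : ∀ i → sumMap (count i) (loose cs) ≤ count i (node w cs)
      loose≤ i = begin
        sumMap (count i) (loose cs)                                                    ≤⟨ m≤m+n _ _ ⟩
        sumMap (count i) (loose cs) + count i c                                        ≤⟨ m≤m+n _ _ ⟩
        sumMap (count i) (loose cs) + count i c + sumMap (count i) (flatten (kept cs)) ≡⟨ sumMap-children cs first (count i) ⟨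
        sumMap (count i) cs                                                            ≤⟨ count-children≤ i w cs ⟩
        count i (node w cs)                                                            ∎

    Distinct-regraft : ∀ w cs {pre c post} H K → splitFirst cs ≡ just (pre , c , post) →
                       Distinct (node w cs ∷ H ∷ K) → Distinct (c ∷ node w (regraft cs H) ∷ K)
    Distinct-regraft w cs {c = c} H K first d = Distinct-≤ (λ i → ≤-reflexive (begin
      count i c + (count i (node w R) + sumMap (count i) K)   ≡⟨ +-assoc (count i c) _ _ ⟨
      count i c + count i (node w R) + sumMap (count i) K     ≡⟨ cong (_+ sumMap (count i) K) (counts i) ⟩
      count i (node w cs) + count i H + sumMap (count i) K    ≡⟨ +-assoc (count i (node w cs)) _ _ ⟩
      count i (node w cs) + (count i H + sumMap (count i) K)  ∎)) d
      where
      open ≡-Reasoning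
      R = regraft cs H
      counts : ∀ i → count i c + count i (node w R) ≡ count i (node w cs) + count i H
      counts i = begin
        count i c + count i (node w R)                                   ≡⟨ cong₂ _+_ (count≡total i c) (count≡total i (node w R)) ⟩
        total (labelCount i) c + total (labelCount i) (node w R)         ≡⟨ total-regraft cs first (Distinct-loose w cs H K first d) w (labelCount i) ⟩
        total (labelCount i) (node w cs) + total (labelCount i) H        ≡⟨ cong₂ _+_ (count≡total i (node w cs)) (count≡total i H) ⟨
        count i (node w cs) + count i H                                  ∎

    count≤regraft : ∀ i w cs H → count i H ≤ count i (node w (regraft cs H))
    count≤regraft i w cs H = begin
      count i H                                                                   ≤⟨ m≤n+m _ _ ⟩
      sumMap (count i) (loose cs) + count i H                                     ≤⟨ m≤m+n _ _ ⟩
      sumMap (count i) (loose cs) + count i H + sumMap (count i) (flatten (kept cs)) ≡⟨ sumMap-graft (count i) (loose cs) H (kept cs) ⟨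
      sumMap (count i) (regraft cs H)                                             ≤⟨ count-children≤ i w (regraft cs H) ⟩
      count i (node w (regraft cs H))                                             ∎
      where open ≤-Reasoning

    record Descended (T H : PTree n) (K : List (PTree n)) : Set where
      field
        e y : ℕ
        root≡ : root (descend T H K) ≡ g
        total≡ : ∀ h → total h (descend T H K) + h g e y ≡
                       total h T + total h H + sumMap (total h) K + h g (e + length K) (suc y)

    DescendsFrom : PTree n → Set
    DescendsFrom T = ∀ H K → 1 ≤ count g T → Distinct (T ∷ H ∷ K) → Descended T H K

    descended-here : ∀ cs H K → Distinct (node g cs ∷ H ∷ K) → Descended (node g cs) H K
    descended-here cs H K d = record { e = e ; y = y ; root≡ = cong root (descend-here cs H K) ; total≡ = total≡ }
      where
      open ≡-Reasoning
      e = elderCount cs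
      y = youngerCount cs
      N = graft K H (segments cs)
      dKH : Distinct (K ∷ʳ H)
      dKH = Distinct-↭ (↭-sym (∷↭∷ʳ H K)) (Distinct-++⁻ʳ (node g cs ∷ []) d)
      elderCount-N : elderCount N ≡ e + length K
      elderCount-N = trans (elderCount-graft K H (segments cs) dKH (segments-canonical cs))
                           (cong (λ xs → elderCount xs + length K) (flatten-segments cs))
      youngerCount-N : youngerCount N ≡ suc y
      youngerCount-N = trans (youngerCount-graft K H (segments cs) dKH (segments-canonical cs))
                             (cong suc (sym (youngerCount-segments cs)))
      total≡ : ∀ h → total h (descend (node g cs) H K) + h g e y ≡
                     total h (node g cs) + total h H + sumMap (total h) K + h g (e + length K) (suc y)
      total≡ h = begin
        total h (descend (node g cs) H K) + h g e y
          ≡⟨ cong (λ t → total h t + h g e y) (descend-here cs H K) ⟩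
        total h (node g N) + h g e y
          ≡⟨ cong (_+ h g e y) (total-node h g N) ⟩
        h g (elderCount N) (youngerCount N) + sumMap (total h) N + h g e y
          ≡⟨ cong₂ (λ a b → h g a b + sumMap (total h) N + h g e y) elderCount-N youngerCount-N ⟩
        h g (e + length K) (suc y) + sumMap (total h) N + h g e y
          ≡⟨ cong (λ s → h g (e + length K) (suc y) + s + h g e y) (sumMap-graft (total h) K H (segments cs)) ⟩
        h g (e + length K) (suc y) + (sumMap (total h) K + total h H + sumMap (total h) (flatten (segments cs))) + h g e y
          ≡⟨ cong (λ xs → h g (e + length K) (suc y) + (sumMap (total h) K + total h H + sumMap (total h) xs) + h g e y)
                  (flatten-segments cs) ⟩
        h g (e + length K) (suc y) + (sumMap (total h) K + total h H + sumMap (total h) cs) + h g e y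
          ≡⟨ rearrange (h g (e + length K) (suc y)) (sumMap (total h) K) (total h H) (sumMap (total h) cs) (h g e y) ⟩
        h g e y + sumMap (total h) cs + total h H + sumMap (total h) K + h g (e + length K) (suc y)
          ≡⟨ cong (λ t → t + total h H + sumMap (total h) K + h g (e + length K) (suc y)) (total-node h g cs) ⟨
        total h (node g cs) + total h H + sumMap (total h) K + h g (e + length K) (suc y) ∎
        where
        rearrange : ∀ s k x c r → s + (k + x + c) + r ≡ r + c + x + k + s
        rearrange = solve-∀

    descended-step : ∀ w cs → (∀ {c} → c ∈ cs → DescendsFrom c) → DescendsFrom (node w cs)
    descended-step w cs IH H K g∈T d with w ≟ g
    ... | yes refl = descended-here cs H K d
    ... | no w≢g with first-exists cs (subst (1 ≤_) (count-node-≢ cs (w≢g ∘ sym)) g∈T)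
    ...   | pre , c , post , first = record { e = D.e ; y = D.y ; root≡ = trans (cong root descend≡) D.root≡ ; total≡ = total≡ }
      where
      R = regraft cs H
      module D = Descended (IH (first-∈ cs first) (node w R) K (first-contains cs first) (Distinct-regraft w cs H K first d))
      descend≡ : descend (node w cs) H K ≡ descend c (node w R) K
      descend≡ = trans (descend-there cs H K w≢g) (descendInto-first w cs cs H K first)
      total≡ : ∀ h → total h (descend (node w cs) H K) + h g D.e D.y ≡
                     total h (node w cs) + total h H + sumMap (total h) K + h g (D.e + length K) (suc D.y)
      total≡ h = trans (cong (λ t → total h t + h g D.e D.y) descend≡) (trans (D.total≡ h)
        (cong (λ t → t + sumMap (total h) K + h g (D.e + length K) (suc D.y))
              (total-regraft cs first (Distinct-loose w cs H K first d) w h)))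

    descended : ∀ T → DescendsFrom T
    descended = PTree-ind DescendsFrom descended-step

    module _ cs {pre c post} (first : splitFirst cs ≡ just (pre , c , post)) where

      youngerCount-children : youngerCount cs ≡ suc (youngerCount (flatten (kept cs)))
      youngerCount-children = trans (youngerCount-segments cs)
        (trans (length-kept cs first) (cong suc (sym (youngerCount-flatten (kept cs) (kept-canonical cs first)))))

      elderCount-children : elderCount cs ≡ elderCount (flatten (kept cs)) + length (loose cs)
      elderCount-children = elderCount-shift cs (flatten (kept cs)) (length (loose cs)) 1
        (trans (↭-length (children-↭ cs first)) (length-∷ʳ-++ (loose cs) c (flatten (kept cs))))
        (trans youngerCount-children (+-comm 1 _))

    -- reroot T has the vertex shapes of T, except that root T goes from (e + k, 1 + y) to (e , y)
    -- and g from (e₀ , y₀) to (e₀ + k , 1 + y₀); quantifying over h states this as multisets.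
    record Rerooted (T : PTree n) : Set where
      field
        e₀ y₀ e y k : ℕ
        root≡ : root (reroot T) ≡ g
        total≡ : ∀ h → total h (reroot T) + h g e₀ y₀ + h (root T) (e + k) (suc y) ≡
                       total h T + h (root T) e y + h g (e₀ + k) (suc y₀)

    module _ {T} (R : Rerooted T) where
      open Rerooted R

      count-reroot : ∀ i → count i (reroot T) ≡ count i T
      count-reroot i = begin
        count i (reroot T)  ≡⟨ count≡total i (reroot T) ⟩
        t′                  ≡⟨ +-cancelʳ-≡ (δ i g + δ i a) t′ t (begin
          t′ + (δ i g + δ i a)  ≡⟨ +-assoc t′ (δ i g) (δ i a) ⟨
          t′ + δ i g + δ i a    ≡⟨ total≡ (labelCount i) ⟩
          t + δ i a + δ i g     ≡⟨ +-assoc t (δ i a) (δ i g) ⟩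
          t + (δ i a + δ i g)   ≡⟨ cong (t +_) (+-comm (δ i a) (δ i g)) ⟩
          t + (δ i g + δ i a)   ∎) ⟩
        t                   ≡⟨ count≡total i T ⟨
        count i T           ∎
        where
        open ≡-Reasoning
        a = root T
        t′ = total (labelCount i) (reroot T)
        t = total (labelCount i) T

      eld-reroot : eld (reroot T) ≡ eld T
      eld-reroot = begin
        eld (reroot T)  ≡⟨ eld≡total (reroot T) ⟩
        t′              ≡⟨ +-cancelʳ-≡ (e₀ + e + k) t′ t (begin
          t′ + (e₀ + e + k)   ≡⟨ rearrange t′ e₀ e k ⟩
          t′ + e₀ + (e + k)   ≡⟨ total≡ elderStatistic ⟩
          t + e + (e₀ + k)    ≡⟨ rearrange′ t e₀ e k ⟨
          t + (e₀ + e + k)    ∎) ⟩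
        t               ≡⟨ eld≡total T ⟨
        eld T           ∎
        where
        open ≡-Reasoning
        t′ = total elderStatistic (reroot T)
        t = total elderStatistic T
        rearrange : ∀ t e₀ e k → t + (e₀ + e + k) ≡ t + e₀ + (e + k)
        rearrange = solve-∀
        rearrange′ : ∀ t e₀ e k → t + (e₀ + e + k) ≡ t + e + (e₀ + k)
        rearrange′ = solve-∀

      youngExp-reroot : ∀ i → youngExp (reroot T) i + δ i (root T) ≡ youngExp T i + δ i g
      youngExp-reroot i = begin
        youngExp (reroot T) i + δ i a  ≡⟨ cong (_+ δ i a) (youngExp≡total i (reroot T)) ⟩
        t′ + δ i a                     ≡⟨ +-cancelʳ-≡ (Y g y₀ + Y a y) (t′ + δ i a) (t + δ i g) (begin
          t′ + δ i a + (Y g y₀ + Y a y)  ≡⟨ rearrange t′ (δ i a) (Y g y₀) (Y a y) ⟩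
          t′ + Y g y₀ + (δ i a + Y a y)  ≡⟨ cong (t′ + Y g y₀ +_) (if-suc ⌊ i ≟ a ⌋ y) ⟨
          t′ + Y g y₀ + Y a (suc y)      ≡⟨ total≡ (youngerStatistic i) ⟩
          t + Y a y + Y g (suc y₀)       ≡⟨ cong (t + Y a y +_) (if-suc ⌊ i ≟ g ⌋ y₀) ⟩
          t + Y a y + (δ i g + Y g y₀)   ≡⟨ rearrange′ t (δ i g) (Y g y₀) (Y a y) ⟩
          t + δ i g + (Y g y₀ + Y a y)   ∎) ⟩
        t + δ i g                      ≡⟨ cong (_+ δ i g) (youngExp≡total i T) ⟨
        youngExp T i + δ i g           ∎
        where
        open ≡-Reasoning
        a = root T
        t′ = total (youngerStatistic i) (reroot T)
        t = total (youngerStatistic i) T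
        Y : Fin n → ℕ → ℕ
        Y v = youngerStatistic i v 0
        if-suc : ∀ c y → (if c then suc y else 0) ≡ (if c then 1 else 0) + (if c then y else 0)
        if-suc true y = refl
        if-suc false y = refl
        rearrange : ∀ t d p q → t + d + (p + q) ≡ t + p + (d + q)
        rearrange = solve-∀
        rearrange′ : ∀ t d p q → t + q + (d + p) ≡ t + d + (p + q)
        rearrange′ = solve-∀

    module Top {v} cs (v≢g : v ≢ g) (g∈T : 1 ≤ count g (node v cs)) (d : Distinct (node v cs ∷ [])) where
      private
        found = first-exists cs (subst (1 ≤_) (count-node-≢ cs (v≢g ∘ sym)) g∈T)

      c : PTree n
      c = proj₁ (proj₂ found)

      first : splitFirst cs ≡ just (proj₁ found , c , proj₁ (proj₂ (proj₂ found)))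
      first = proj₂ (proj₂ (proj₂ found))

      H₀ : PTree n
      H₀ = node v (flatten (kept cs))

      reroot≡ : reroot (node v cs) ≡ descend c H₀ (loose cs)
      reroot≡ = rerootFrom-first v cs cs first

      path-distinct : Distinct (c ∷ H₀ ∷ loose cs)
      path-distinct = Distinct-≤ (λ i → ≤-reflexive (begin
        count i c + (count i H₀ + sumMap (count i) (loose cs))
          ≡⟨ cong (λ x → count i c + (x + sumMap (count i) (loose cs))) (count-node i v (flatten (kept cs))) ⟩
        count i c + (δ i v + sumMap (count i) (flatten (kept cs)) + sumMap (count i) (loose cs))
          ≡⟨ rearrange (count i c) (δ i v) _ _ ⟩
        δ i v + (sumMap (count i) (loose cs) + count i c + sumMap (count i) (flatten (kept cs))) + 0
          ≡⟨ cong (λ x → δ i v + x + 0) (sumMap-children cs first (count i)) ⟨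
        δ i v + sumMap (count i) cs + 0
          ≡⟨ cong (_+ 0) (count-node i v cs) ⟨
        count i (node v cs) + 0 ∎)) d
        where
        open ≡-Reasoning
        rearrange : ∀ x d f l → x + (d + f + l) ≡ d + (l + x + f) + 0
        rearrange = solve-∀

      rerooted : Rerooted (node v cs)
      rerooted = record
        { e₀ = D.e ; y₀ = D.y ; e = elderCount F ; y = youngerCount F ; k = length (loose cs)
        ; root≡ = trans (cong root reroot≡) D.root≡
        ; total≡ = total≡
        }
        where
        F = flatten (kept cs)
        module D = Descended (descended c H₀ (loose cs) (first-contains cs first) path-distinct)
        total≡ : ∀ h → total h (reroot (node v cs)) + h g D.e D.y + h v (elderCount F + length (loose cs)) (suc (youngerCount F)) ≡
                       total h (node v cs) + h v (elderCount F) (youngerCount F) + h g (D.e + length (loose cs)) (suc D.y)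
        total≡ h = begin
          total h (reroot (node v cs)) + h g D.e D.y + s
            ≡⟨ cong (λ t → total h t + h g D.e D.y + s) reroot≡ ⟩
          total h (descend c H₀ (loose cs)) + h g D.e D.y + s
            ≡⟨ cong (_+ s) (D.total≡ h) ⟩
          total h c + total h H₀ + sumMap (total h) (loose cs) + r + s
            ≡⟨ cong (λ t → total h c + t + sumMap (total h) (loose cs) + r + s) (total-node h v F) ⟩
          total h c + (h v (elderCount F) (youngerCount F) + sumMap (total h) F) + sumMap (total h) (loose cs) + r + s
            ≡⟨ rearrange (total h c) (h v (elderCount F) (youngerCount F)) (sumMap (total h) F) (sumMap (total h) (loose cs)) r s ⟩
          s + (sumMap (total h) (loose cs) + total h c + sumMap (total h) F) + h v (elderCount F) (youngerCount F) + r
            ≡⟨ cong (λ x → s + x + h v (elderCount F) (youngerCount F) + r) (sumMap-children cs first (total h)) ⟨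
          s + sumMap (total h) cs + h v (elderCount F) (youngerCount F) + r
            ≡⟨ cong (λ x → x + sumMap (total h) cs + h v (elderCount F) (youngerCount F) + r) shape ⟨
          h v (elderCount cs) (youngerCount cs) + sumMap (total h) cs + h v (elderCount F) (youngerCount F) + r
            ≡⟨ cong (λ x → x + h v (elderCount F) (youngerCount F) + r) (total-node h v cs) ⟨
          total h (node v cs) + h v (elderCount F) (youngerCount F) + r ∎
          where
          open ≡-Reasoning
          r = h g (D.e + length (loose cs)) (suc D.y)
          s = h v (elderCount F + length (loose cs)) (suc (youngerCount F))
          shape : h v (elderCount cs) (youngerCount cs) ≡ s
          shape = cong₂ (h v) (elderCount-children cs first) (youngerCount-children cs first)
          rearrange : ∀ x a f l r s → x + (a + f) + l + r + s ≡ s + (l + x + f) + a + r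
          rearrange = solve-∀

  module RoundTrip (a b : Fin n) where
    private
      module A = Reroot a
      module B = Reroot b

    ReturnsFrom : PTree n → Set
    ReturnsFrom T = ∀ H K → 1 ≤ count b T → 1 ≤ count a H → Distinct (T ∷ H ∷ K) →
                    A.reroot (B.descend T H K) ≡ A.descend H T K

    returns-here : ∀ cs H K → 1 ≤ count a H → Distinct (node b cs ∷ H ∷ K) →
                   A.reroot (B.descend (node b cs) H K) ≡ A.descend H (node b cs) K
    returns-here cs H K a∈H d = begin
      A.reroot (B.descend (node b cs) H K)                     ≡⟨ cong A.reroot (B.descend-here cs H K) ⟩
      A.rerootFrom b N N                                       ≡⟨ A.rerootFrom-first b N N firstH ⟩
      A.descend H (node b (flatten (A.kept N))) (A.loose N)    ≡⟨ cong (λ (S , w) → A.descend H (node b (flatten S)) w) extract≡ ⟩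
      A.descend H (node b (flatten (segments cs))) K           ≡⟨ cong (λ xs → A.descend H (node b xs) K) (flatten-segments cs) ⟩
      A.descend H (node b cs) K                                ∎
      where
      open ≡-Reasoning
      N = graft K H (segments cs)
      elsewhere = Distinct-elsewhere a∈H d
      containsH = contains-true a H a∈H
      noneK = contains-none a K (proj₂ elsewhere)
      noneCs = contains-none a (flatten (segments cs))
                 (trans (cong (sumMap (count a)) (flatten-segments cs))
                        (n≤0⇒n≡0 (≤-trans (count-children≤ a b cs) (≤-reflexive (proj₁ elsewhere)))))
      firstH = proj₂ (proj₂ (A.splitFirst-graft K H (segments cs) noneK containsH noneCs))
      extract≡ : A.extract (segments N) ≡ (segments cs , K)
      extract≡ = A.extract-graft K H (segments cs) (Distinct-↭ (↭-sym (∷↭∷ʳ H K)) (Distinct-++⁻ʳ (node b cs ∷ []) d))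
                   (segments-canonical cs) noneK containsH noneCs

    returns-step : ∀ w cs → (∀ {c} → c ∈ cs → ReturnsFrom c) → ReturnsFrom (node w cs)
    returns-step w cs IH = returns-node (w ≟ b)
      where
      returns-node : Dec (w ≡ b) → ReturnsFrom (node w cs)
      returns-node (yes refl) H K _ = returns-here cs H K
      returns-node (no w≢b) H K b∈T a∈H d with B.first-exists cs (subst (1 ≤_) (count-node-≢ cs (w≢b ∘ sym)) b∈T)
      ... | pre , x , post , first = begin
        A.reroot (B.descend (node w cs) H K)
          ≡⟨ cong A.reroot (trans (B.descend-there cs H K w≢b) (B.descendInto-first w cs cs H K first)) ⟩
        A.reroot (B.descend x (node w R) K)
          ≡⟨ IH (B.first-∈ cs first) (node w R) K (B.first-contains cs first) (≤-trans a∈H (B.count≤regraft a w cs H))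
                (B.Distinct-regraft w cs H K first d) ⟩
        A.descend (node w R) x K
          ≡⟨ A.descend-there R x K w≢a ⟩
        A.descendInto w R R x K
          ≡⟨ A.descendInto-first w R R x K firstH ⟩
        A.descend H (node w (A.regraft R x)) K
          ≡⟨ cong (λ (S , l) → A.descend H (node w (graft l x S)) K) extract≡ ⟩
        A.descend H (node w (B.regraft cs x)) K
          ≡⟨ cong (λ xs → A.descend H (node w xs) K) (B.reinsert cs first (Distinct-children d)) ⟩
        A.descend H (node w cs) K ∎
        where
        open ≡-Reasoning
        R = B.regraft cs H
        elsewhere = Distinct-elsewhere a∈H d
        w≢a : w ≢ a
        w≢a refl = contradiction (proj₁ elsewhere) (>⇒≢ (count-root w cs))
        parts : sumMap (count a) (B.loose cs) + count a x + sumMap (count a) (flatten (B.kept cs)) ≡ 0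
        parts = trans (sym (B.sumMap-children cs first (count a)))
                      (n≤0⇒n≡0 (≤-trans (count-children≤ a w cs) (≤-reflexive (proj₁ elsewhere))))
        noneLoose = contains-none a (B.loose cs) (m+n≡0⇒m≡0 _ (m+n≡0⇒m≡0 _ parts))
        noneKept = contains-none a (flatten (B.kept cs)) (m+n≡0⇒n≡0 _ parts)
        containsH = contains-true a H a∈H
        firstH = proj₂ (proj₂ (A.splitFirst-graft (B.loose cs) H (B.kept cs) noneLoose containsH noneKept))
        extract≡ : A.extract (segments R) ≡ (B.kept cs , B.loose cs)
        extract≡ = A.extract-graft (B.loose cs) H (B.kept cs) (B.Distinct-loose w cs H K first d) (B.kept-canonical cs first)
                     noneLoose containsH noneKept

    returns : ∀ T → ReturnsFrom T
    returns = PTree-ind ReturnsFrom returns-step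

    reroot-involutive : ∀ cs → a ≢ b → 1 ≤ count b (node a cs) → Distinct (node a cs ∷ []) →
                        A.reroot (B.reroot (node a cs)) ≡ node a cs
    reroot-involutive cs a≢b b∈T d = begin
      A.reroot (B.reroot (node a cs))
        ≡⟨ cong A.reroot T.reroot≡ ⟩
      A.reroot (B.descend T.c T.H₀ (B.loose cs))
        ≡⟨ returns T.c T.H₀ (B.loose cs) (B.first-contains cs T.first) (count-root a (flatten (B.kept cs))) T.path-distinct ⟩
      A.descend T.H₀ T.c (B.loose cs)
        ≡⟨ A.descend-here (flatten (B.kept cs)) T.c (B.loose cs) ⟩
      node a (graft (B.loose cs) T.c (segments (flatten (B.kept cs))))
        ≡⟨ cong (node a ∘ graft (B.loose cs) T.c) (segments-flatten _ (B.kept-canonical cs T.first)) ⟩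
      node a (B.regraft cs T.c)
        ≡⟨ cong (node a) (B.reinsert cs T.first (Distinct-children d)) ⟩
      node a cs ∎
      where
      open ≡-Reasoning
      module T = B.Top cs a≢b b∈T d

  allB-cong : ∀ {p q : Fin n → Bool} xs → (∀ i → p i ≡ q i) → allB p xs ≡ allB q xs
  allB-cong [] _ = refl
  allB-cong (x ∷ xs) p≗q = cong₂ _∧_ (p≗q x) (allB-cong xs p≗q)

  allB-∈ : ∀ {p : Fin n → Bool} xs → T (allB p xs) → ∀ {i} → i ∈ xs → T (p i)
  allB-∈ (x ∷ xs) all (here refl) = proj₁ (Equivalence.to T-∧ all)
  allB-∈ (x ∷ xs) all (there i∈xs) = allB-∈ xs (proj₂ (Equivalence.to T-∧ all)) i∈xs

  count≡1 : ∀ {t} → T (isOnAllOfN t) → ∀ i → count i t ≡ 1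
  count≡1 {t} onAll i = ≡ᵇ⇒≡ (count i t) 1 (allB-∈ (allFin n) onAll (∈-allFin i))

  isOnAllOfN-cong : ∀ {t t′} → (∀ i → count i t ≡ count i t′) → isOnAllOfN t ≡ isOnAllOfN t′
  isOnAllOfN-cong counts = allB-cong (allFin n) (λ i → cong (_≡ᵇ 1) (counts i))

  module Rerooting (a b : Fin n) (a≢b : a ≢ b) where
    private
      module B = Reroot b

      b∈T : ∀ cs → T (isOnAllOfN (node a cs)) → 1 ≤ count b (node a cs)
      b∈T cs onAll = ≤-reflexive (sym (count≡1 {node a cs} onAll b))

      distinct-T : ∀ cs → T (isOnAllOfN (node a cs)) → Distinct (node a cs ∷ [])
      distinct-T cs onAll = distinct (λ i → ≤-reflexive (trans (+-identityʳ _) (count≡1 {node a cs} onAll i)))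

      rerooted : ∀ cs → T (isOnAllOfN (node a cs)) → B.Rerooted (node a cs)
      rerooted cs onAll = B.Top.rerooted cs a≢b (b∈T cs onAll) (distinct-T cs onAll)

    reroot-plane : ∀ {t} → IsPlaneTreeWithRoot a t → IsPlaneTreeWithRoot b (B.reroot t)
    reroot-plane {node _ cs} (refl , onAll) =
      B.Rerooted.root≡ R , subst T (sym (isOnAllOfN-cong {B.reroot (node a cs)} {node a cs} (B.count-reroot R))) onAll
      where R = rerooted cs onAll

    monomial-reroot : ∀ {t} → IsPlaneTreeWithRoot a t → monomial b (B.reroot t) ≡ monomial a t
    monomial-reroot {node _ cs} (refl , onAll) = cong₂ _,_ (B.eld-reroot R)
      (tabulate-cong λ i → [+p]-[+r]≡[+q]-[+s] (youngExp (B.reroot (node a cs)) i) (youngExp (node a cs) i) (δ i b) (δ i a)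
                             (B.youngExp-reroot R i))
      where R = rerooted cs onAll

    reroot-back : ∀ {t} → IsPlaneTreeWithRoot a t → Reroot.reroot a (B.reroot t) ≡ t
    reroot-back {node _ cs} (refl , onAll) = RoundTrip.reroot-involutive a b cs a≢b (b∈T cs onAll) (distinct-T cs onAll)

  Contributing : Fin n → ℕ × Vec ℤ n → PTree n → Set
  Contributing r m t = IsPlaneTreeWithRoot r t × monomial r t ≡ m

  Contributing-irrelevant : ∀ r m t (p q : Contributing r m t) → p ≡ q
  Contributing-irrelevant r m t ((root≡ , onAll) , mono) ((root≡′ , onAll′) , mono′) =
    cong₂ _,_ (cong₂ _,_ (Decidable⇒UIP.≡-irrelevant _≟_ root≡ root≡′) (T-irrelevant onAll onAll′))
              (Decidable⇒UIP.≡-irrelevant (≡-dec ℕ._≟_ (Vec.≡-dec ℤ._≟_)) mono mono′)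

  rerootΣ : ∀ {a b m} → a ≢ b → Σ (PTree n) (Contributing a m) → Σ (PTree n) (Contributing b m)
  rerootΣ {a} {b} a≢b (t , isA , mono) =
    Reroot.reroot b t , Rerooting.reroot-plane a b a≢b {t} isA , trans (Rerooting.monomial-reroot a b a≢b {t} isA) mono

  rerootΣ-inverse : ∀ {a b m} (a≢b : a ≢ b) (b≢a : b ≢ a) z → rerootΣ {b} {a} {m} b≢a (rerootΣ a≢b z) ≡ z
  rerootΣ-inverse {a} {b} {m} a≢b b≢a (t , isA , mono) =
    Σ-≡,≡→≡ (Rerooting.reroot-back a b a≢b {t} isA , Contributing-irrelevant a m t _ _)

corollary4p7 : (n : ℕ) (r s : Fin n) → toℕ r < toℕ s →
    (e : ℕ) (a : Vec ℤ n) →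
    (Σ (PTree n) λ T → IsPlaneTreeWithRoot r T × monomial r T ≡ (e , a))
    ↔ (Σ (PTree n) λ T → IsPlaneTreeWithRoot s T × monomial s T ≡ (e , a))
corollary4p7 n r s r<s e a = mk↔ₛ′ (rerootΣ r≢s) (rerootΣ s≢r) (rerootΣ-inverse s≢r r≢s) (rerootΣ-inverse r≢s s≢r)
  where
  r≢s : r ≢ s
  r≢s r≡s = <-irrefl (cong toℕ r≡s) r<s
  s≢r : s ≢ r
  s≢r = r≢s ∘ sym
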